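{- Let $G=(V,E)$ be a finite undirected graph without loops and multiple edges, and let $Q\subseteq E$ be a quasicycle of $G$. Then the set $$\bigoplus_{e\in Q,\ e=\{u,v\}} \bigl(s(u)\cap s(v)\bigr),$$ i.e. the ring sum, over all edges $e$ of $Q$, of the intersection of the central cuts of the two end vertices of $e$, is a quasicycle of $G$.
   Context: Subsets of $E$ are identified with spanning subgraphs of $G$, and the ring sum $A\oplus B=(A\cup B)\setminus(A\cap B)$ is the symmetric difference of edge sets. For a vertex $v$, the central cut $s(v)\subseteq E$ is the set of edges incident to $v$. A quasicycle is a set of edges $Q\subseteq E$ such that every vertex of $G$ is incident to an even number of edges of $Q$ (equivalently, $Q$ is a union of pairwise edge-disjoint cycles). -}

module Defs where

open import Data.Bool using (Bool; true; false; _∧_; _∨_; _xor_; if_then_else_)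
open import Data.Nat using (ℕ; _+_)
open import Data.Nat.Divisibility using (_∣_)
open import Data.Fin using (Fin; _<?_; _≟_)
open import Data.List using (List; []; _∷_; foldr; map; allFin; concatMap; filter)
open import Data.Nat.ListAction using (sum)
open import Data.Product using (_×_; _,_)
open import Relation.Nullary.Decidable using (⌊_⌋)
open import Relation.Binary.PropositionalEquality using (_≡_)

record Graph (n : ℕ) : Set where
  field
    adj    : Fin n → Fin n → Bool
    sym    : ∀ i j → adj i j ≡ adj j i
    irrefl : ∀ i → adj i i ≡ false
open Graph public

-- A set of unordered vertex pairs, encoded as a Bool matrix:
-- A u v = true means the pair {u,v} belongs to A (we require symmetry
-- for it to be a genuine set of unordered pairs).
EdgeMatrix : ℕ → Set
EdgeMatrix n = Fin n → Fin n → Bool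

record IsEdgeSet {n : ℕ} (G : Graph n) (A : EdgeMatrix n) : Set where
  field
    symm  : ∀ u v → A u v ≡ A v u
    ⊆E    : ∀ u v → A u v ≡ true → adj G u v ≡ true
open IsEdgeSet public

_⊕_ : ∀ {n} → EdgeMatrix n → EdgeMatrix n → EdgeMatrix n
(A ⊕ B) u v = A u v xor B u v

_∩_ : ∀ {n} → EdgeMatrix n → EdgeMatrix n → EdgeMatrix n
(A ∩ B) u v = A u v ∧ B u v

∅ : ∀ {n} → EdgeMatrix n
∅ u v = false

s : ∀ {n} → Graph n → Fin n → EdgeMatrix n
s G w i j = adj G i j ∧ (⌊ i ≟ w ⌋ ∨ ⌊ j ≟ w ⌋)

deg : ∀ {n} → EdgeMatrix n → Fin n → ℕ
deg {n} A v = sum (map (λ j → if A v j then 1 else 0) (allFin n))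

record IsQuasicycle {n : ℕ} (G : Graph n) (Q : EdgeMatrix n) : Set where
  field
    edgeSet : IsEdgeSet G Q
    even    : ∀ v → 2 ∣ deg Q v
open IsQuasicycle public

-- The edges {u,v} (listed once each, as u < v) belonging to Q.
edgesOf : ∀ {n} → EdgeMatrix n → List (Fin n × Fin n)
edgesOf {n} Q =
  concatMap (λ u → map (λ v → (u , v))
    (filter (λ v → Data.Bool.T? (⌊ u <? v ⌋ ∧ Q u v)) (allFin n))) (allFin n)
  where import Data.Bool

⨁[e∈_] : ∀ {n} → EdgeMatrix n → (Fin n → Fin n → EdgeMatrix n) → EdgeMatrix n
⨁[e∈ Q ] F = foldr (λ { (u , v) acc → F u v ⊕ acc }) ∅ (edgesOf Q)

{-# OPTIONS --safe #-}
-- For an edge uv of a simple graph, s(u) ∩ s(v) = {uv}, so the ring sum over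
-- the edges of Q is Q itself. Evaluated at (i, j), the ring sum is the parity of
-- the pairs u < v of Q with {u, v} = {i, j}, and only (i, j) or (j, i) can qualify.
module Submission where

open import Defs hiding (sym)
open import Algebra.Bundles using (CommutativeMonoid; CommutativeRing)
open import Data.Bool using (Bool; true; false; _∧_; _∨_; _xor_; T?; if_then_else_)
open import Data.Bool.Properties
  using (∧-idem; ∧-zeroʳ; ∧-distribˡ-xor; xor-assoc; xor-identityʳ;
         ∧-commutativeMonoid; xor-∧-commutativeRing)
open import Data.Fin using (Fin; zero; suc; _<_; _<?_; _≟_)
open import Data.Fin.Properties using (<-cmp; <-asym; <⇒≢)
open import Data.List
  using (List; []; _∷_; _++_; foldr; map; concatMap; filter; allFin; tabulate)
open import Data.List.Properties using (foldr-fusion; foldr-map; map-tabulate; map-cong)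
open import Data.Nat as ℕ using (ℕ)
open import Data.Nat.Divisibility using (_∣_)
open import Data.Nat.ListAction using (sum)
open import Data.Product using (_×_; _,_)
open import Function using (id; _∘_)
open import Relation.Binary.Definitions using (tri<; tri≈; tri>)
open import Relation.Binary.PropositionalEquality
  using (_≡_; _≢_; _≗_; refl; sym; trans; cong; cong₂; subst; module ≡-Reasoning)
open import Relation.Nullary using (yes; no; contradiction)
open import Relation.Nullary.Decidable using (⌊_⌋; ⌊⌋-map′)

open import Algebra.Properties.CommutativeSemigroup
  (CommutativeRing.+-commutativeSemigroup xor-∧-commutativeRing)
  using () renaming (interchange to xor-interchange)
open import Algebra.Properties.CommutativeSemigroup
  (CommutativeMonoid.commutativeSemigroup ∧-commutativeMonoid)
  using () renaming (interchange to ∧-interchange; x∙yz≈y∙xz to ∧-leftComm; x∙yz≈y∙zx to ∧-rotate)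

open ≡-Reasoning

private variable
  A B : Set

parity : (A → Bool) → List A → Bool
parity f = foldr (λ x b → f x xor b) false

parity-cong : ∀ {f g : A → Bool} → f ≗ g → parity f ≗ parity g
parity-cong f≗g []       = refl
parity-cong f≗g (x ∷ xs) = cong₂ _xor_ (f≗g x) (parity-cong f≗g xs)

parity-++ : ∀ f (xs ys : List A) → parity f (xs ++ ys) ≡ parity f xs xor parity f ys
parity-++ f []       ys = refl
parity-++ f (x ∷ xs) ys = trans (cong (f x xor_) (parity-++ f xs ys)) (sym (xor-assoc (f x) _ _))

parity-concatMap : ∀ f (g : A → List B) xs →
                   parity f (concatMap g xs) ≡ parity (parity f ∘ g) xs
parity-concatMap f g []       = refl
parity-concatMap f g (x ∷ xs) =
  trans (parity-++ f (g x) _) (cong (parity f (g x) xor_) (parity-concatMap f g xs))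

parity-filter : ∀ f (p : A → Bool) xs →
                parity f (filter (T? ∘ p) xs) ≡ parity (λ x → p x ∧ f x) xs
parity-filter f p []       = refl
parity-filter f p (x ∷ xs) with p x
... | true  = cong (f x xor_) (parity-filter f p xs)
... | false = parity-filter f p xs

parity-xor : ∀ (f g : A → Bool) xs → parity (λ x → f x xor g x) xs ≡ parity f xs xor parity g xs
parity-xor f g []       = refl
parity-xor f g (x ∷ xs) =
  trans (cong ((f x xor g x) xor_) (parity-xor f g xs)) (xor-interchange (f x) (g x) _ _)

parity-distribˡ-∧ : ∀ b (f : A → Bool) xs → parity (λ x → b ∧ f x) xs ≡ b ∧ parity f xs
parity-distribˡ-∧ b f []       = sym (∧-zeroʳ b)
parity-distribˡ-∧ b f (x ∷ xs) =
  trans (cong ((b ∧ f x) xor_) (parity-distribˡ-∧ b f xs)) (sym (∧-distribˡ-xor b (f x) _))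

parityᶠ : ∀ {n} → (Fin n → Bool) → Bool
parityᶠ {n} f = parity f (allFin n)

syntax parityᶠ (λ x → e) = ⊕[ x ] e

parityᶠ-suc : ∀ {n} (f : Fin (ℕ.suc n) → Bool) → parityᶠ f ≡ f zero xor parityᶠ (f ∘ suc)
parityᶠ-suc {n} f = cong (f zero xor_) (begin
  parity f (tabulate suc)       ≡⟨ cong (parity f) (sym (map-tabulate id suc)) ⟩
  parity f (map suc (allFin n)) ≡⟨ foldr-map _ suc false (allFin n) ⟩
  parity (f ∘ suc) (allFin n)   ∎)

parityᶠ-select : ∀ {n} (h : Fin n → Bool) k → (⊕[ v ] (⌊ k ≟ v ⌋ ∧ h v)) ≡ h k
parityᶠ-select {ℕ.suc n} h zero = begin
  (⊕[ v ] (⌊ zero ≟ v ⌋ ∧ h v))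
    ≡⟨ parityᶠ-suc (λ v → ⌊ zero ≟ v ⌋ ∧ h v) ⟩
  h zero xor (⊕[ v ] (false ∧ h (suc v)))
    ≡⟨ cong (h zero xor_) (parity-distribˡ-∧ false (h ∘ suc) (allFin n)) ⟩
  h zero xor false
    ≡⟨ xor-identityʳ (h zero) ⟩
  h zero ∎
parityᶠ-select {ℕ.suc n} h (suc k) = begin
  (⊕[ v ] (⌊ suc k ≟ v ⌋ ∧ h v))
    ≡⟨ parityᶠ-suc (λ v → ⌊ suc k ≟ v ⌋ ∧ h v) ⟩
  (⊕[ v ] (⌊ suc k ≟ suc v ⌋ ∧ h (suc v)))
    ≡⟨ parity-cong (λ v → cong (_∧ h (suc v)) (⌊⌋-map′ _ _ (k ≟ v))) (allFin n) ⟩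
  (⊕[ v ] (⌊ k ≟ v ⌋ ∧ h (suc v)))
    ≡⟨ parityᶠ-select (h ∘ suc) k ⟩
  h (suc k) ∎

parityᶠ²-select : ∀ {n} (g : Fin n → Fin n → Bool) i j →
                  (⊕[ u ] ⊕[ v ] (g u v ∧ (⌊ i ≟ u ⌋ ∧ ⌊ j ≟ v ⌋))) ≡ g i j
parityᶠ²-select {n} g i j = begin
  (⊕[ u ] ⊕[ v ] (g u v ∧ (⌊ i ≟ u ⌋ ∧ ⌊ j ≟ v ⌋)))
    ≡⟨ parity-cong (λ u → trans (parity-cong (λ v → ∧-rotate (g u v) ⌊ i ≟ u ⌋ ⌊ j ≟ v ⌋) (allFin n))
                                (parity-distribˡ-∧ ⌊ i ≟ u ⌋ (λ v → ⌊ j ≟ v ⌋ ∧ g u v) (allFin n)))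
                   (allFin n) ⟩
  (⊕[ u ] (⌊ i ≟ u ⌋ ∧ (⊕[ v ] (⌊ j ≟ v ⌋ ∧ g u v))))
    ≡⟨ parityᶠ-select _ i ⟩
  (⊕[ v ] (⌊ j ≟ v ⌋ ∧ g i v))
    ≡⟨ parityᶠ-select (g i) j ⟩
  g i j ∎

listed : ∀ {n} → EdgeMatrix n → Fin n → Fin n → Bool
listed Q u v = ⌊ u <? v ⌋ ∧ Q u v

⨁-unfold : ∀ {n} (Q : EdgeMatrix n) F i j →
           (⨁[e∈ Q ] F) i j ≡ (⊕[ u ] ⊕[ v ] (listed Q u v ∧ F u v i j))
⨁-unfold {n} Q F i j = begin
  (⨁[e∈ Q ] F) i j
    ≡⟨ foldr-fusion (λ M → M i j) ∅ (λ { (u , v) _ → refl }) (edgesOf Q) ⟩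
  parity F[_]ij (edgesOf Q)
    ≡⟨ parity-concatMap F[_]ij (λ u → map (u ,_) (successors u)) (allFin n) ⟩
  (⊕[ u ] parity F[_]ij (map (u ,_) (successors u)))
    ≡⟨ parity-cong (λ u → trans (foldr-map (λ e b → F[ e ]ij xor b) (u ,_) false (successors u))
                                (parity-filter (λ v → F u v i j) (listed Q u) (allFin n)))
                   (allFin n) ⟩
  (⊕[ u ] ⊕[ v ] (listed Q u v ∧ F u v i j)) ∎
  where
  F[_]ij : Fin n × Fin n → Bool
  F[ u , v ]ij = F u v i j
  successors : Fin n → List (Fin n)
  successors u = filter (T? ∘ listed Q u) (allFin n)

⨁-cong : ∀ {n} (Q : EdgeMatrix n) {F F′ : Fin n → Fin n → EdgeMatrix n} →
         (∀ {u v} → u < v → ∀ i j → F u v i j ≡ F′ u v i j) →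
         ∀ i j → (⨁[e∈ Q ] F) i j ≡ (⨁[e∈ Q ] F′) i j
⨁-cong {n} Q {F} {F′} F≐F′ i j =
  trans (⨁-unfold Q F i j)
        (trans (parity-cong (λ u → parity-cong (term u) (allFin n)) (allFin n))
               (sym (⨁-unfold Q F′ i j)))
  where
  term : ∀ u v → listed Q u v ∧ F u v i j ≡ listed Q u v ∧ F′ u v i j
  term u v with u <? v
  ... | yes u<v = cong (Q u v ∧_) (F≐F′ u<v i j)
  ... | no _    = refl

⨁-∩ˡ : ∀ {n} (Q A : EdgeMatrix n) F i j →
       (⨁[e∈ Q ] (λ u v → A ∩ F u v)) i j ≡ A i j ∧ (⨁[e∈ Q ] F) i j
⨁-∩ˡ {n} Q A F i j = begin
  (⨁[e∈ Q ] (λ u v → A ∩ F u v)) i j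
    ≡⟨ ⨁-unfold Q (λ u v → A ∩ F u v) i j ⟩
  (⊕[ u ] ⊕[ v ] (listed Q u v ∧ (A i j ∧ F u v i j)))
    ≡⟨ parity-cong (λ u → trans (parity-cong (λ v → ∧-leftComm (listed Q u v) (A i j) _) (allFin n))
                                (parity-distribˡ-∧ (A i j) (λ v → listed Q u v ∧ F u v i j) (allFin n)))
                   (allFin n) ⟩
  (⊕[ u ] (A i j ∧ (⊕[ v ] (listed Q u v ∧ F u v i j))))
    ≡⟨ parity-distribˡ-∧ (A i j) _ (allFin n) ⟩
  A i j ∧ (⊕[ u ] ⊕[ v ] (listed Q u v ∧ F u v i j))
    ≡⟨ cong (A i j ∧_) (sym (⨁-unfold Q F i j)) ⟩
  A i j ∧ (⨁[e∈ Q ] F) i j ∎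

-- xor rather than ∨ makes edge u v additive under ring sums; for u ≢ v the two agree.
edge : ∀ {n} → Fin n → Fin n → EdgeMatrix n
edge u v i j = (⌊ i ≟ u ⌋ ∧ ⌊ j ≟ v ⌋) xor (⌊ j ≟ u ⌋ ∧ ⌊ i ≟ v ⌋)

incident-to-both≡edge : ∀ {n} {u v : Fin n} → u ≢ v → ∀ i j →
                        (⌊ i ≟ u ⌋ ∨ ⌊ j ≟ u ⌋) ∧ (⌊ i ≟ v ⌋ ∨ ⌊ j ≟ v ⌋) ≡ edge u v i j
incident-to-both≡edge {u = u} {v} u≢v i j with i ≟ u | i ≟ v
... | yes refl | yes refl = contradiction refl u≢v
... | yes refl | no _     = sym (trans (cong (⌊ j ≟ v ⌋ xor_) (∧-zeroʳ _)) (xor-identityʳ _))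
... | no _     | yes refl = refl
... | no _     | no _     with j ≟ u
...   | no _    = refl
...   | yes refl with u ≟ v
...     | yes u≡v = contradiction u≡v u≢v
...     | no _    = refl

s∩s≡adj∩edge : ∀ {n} (G : Graph n) {u v} → u ≢ v →
               ∀ i j → (s G u ∩ s G v) i j ≡ (adj G ∩ edge u v) i j
s∩s≡adj∩edge G {u} {v} u≢v i j = begin
  (adj G i j ∧ (⌊ i ≟ u ⌋ ∨ ⌊ j ≟ u ⌋)) ∧ (adj G i j ∧ (⌊ i ≟ v ⌋ ∨ ⌊ j ≟ v ⌋))
    ≡⟨ ∧-interchange (adj G i j) _ (adj G i j) _ ⟩
  (adj G i j ∧ adj G i j) ∧ ((⌊ i ≟ u ⌋ ∨ ⌊ j ≟ u ⌋) ∧ (⌊ i ≟ v ⌋ ∨ ⌊ j ≟ v ⌋))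
    ≡⟨ cong₂ _∧_ (∧-idem (adj G i j)) (incident-to-both≡edge u≢v i j) ⟩
  adj G i j ∧ edge u v i j ∎

listed-xor-flip : ∀ {n} (Q : EdgeMatrix n) → (∀ i j → Q i j ≡ Q j i) → (∀ i → Q i i ≡ false) →
                  ∀ i j → listed Q i j xor listed Q j i ≡ Q i j
listed-xor-flip Q Q-sym Q-irrefl i j with i <? j | j <? i
... | yes i<j | yes j<i = contradiction j<i (<-asym i<j)
... | yes _   | no _    = xor-identityʳ (Q i j)
... | no _    | yes _   = Q-sym j i
... | no i≮j  | no j≮i  with <-cmp i j
...   | tri< i<j _ _  = contradiction i<j i≮j
...   | tri> _ _ j<i  = contradiction j<i j≮i
...   | tri≈ _ refl _ = sym (Q-irrefl i)

⨁-edge : ∀ {n} (Q : EdgeMatrix n) → (∀ i j → Q i j ≡ Q j i) → (∀ i → Q i i ≡ false) →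
         ∀ i j → (⨁[e∈ Q ] edge) i j ≡ Q i j
⨁-edge {n} Q Q-sym Q-irrefl i j = begin
  (⨁[e∈ Q ] edge) i j
    ≡⟨ ⨁-unfold Q edge i j ⟩
  (⊕[ u ] ⊕[ v ] (listed Q u v ∧ (⌊ i ≟ u ⌋ ∧ ⌊ j ≟ v ⌋ xor ⌊ j ≟ u ⌋ ∧ ⌊ i ≟ v ⌋)))
    ≡⟨ parity-cong (λ u → trans (parity-cong (λ v → ∧-distribˡ-xor (listed Q u v) _ _) (allFin n))
                                (parity-xor (listed-at i j u) (listed-at j i u) (allFin n)))
                   (allFin n) ⟩
  (⊕[ u ] ((⊕[ v ] listed-at i j u v) xor (⊕[ v ] listed-at j i u v)))
    ≡⟨ parity-xor (λ u → ⊕[ v ] listed-at i j u v) (λ u → ⊕[ v ] listed-at j i u v) (allFin n) ⟩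
  (⊕[ u ] ⊕[ v ] listed-at i j u v) xor (⊕[ u ] ⊕[ v ] listed-at j i u v)
    ≡⟨ cong₂ _xor_ (parityᶠ²-select (listed Q) i j) (parityᶠ²-select (listed Q) j i) ⟩
  listed Q i j xor listed Q j i
    ≡⟨ listed-xor-flip Q Q-sym Q-irrefl i j ⟩
  Q i j ∎
  where
  listed-at : Fin n → Fin n → Fin n → Fin n → Bool
  listed-at a b u v = listed Q u v ∧ (⌊ a ≟ u ⌋ ∧ ⌊ b ≟ v ⌋)

module _ {n} {G : Graph n} {A : EdgeMatrix n} (A⊆E : IsEdgeSet G A) where

  edgeSet-irrefl : ∀ i → A i i ≡ false
  edgeSet-irrefl i with A i i in Aii
  ... | false = refl
  ... | true  = trans (sym (⊆E A⊆E i i Aii)) (irrefl G i)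

  adj∩edgeSet : ∀ i j → adj G i j ∧ A i j ≡ A i j
  adj∩edgeSet i j with A i j in Aij
  ... | false = ∧-zeroʳ (adj G i j)
  ... | true  = cong (_∧ true) (⊆E A⊆E i j Aij)

deg-cong : ∀ {n} {A B : EdgeMatrix n} → (∀ i j → A i j ≡ B i j) → ∀ v → deg A v ≡ deg B v
deg-cong A≐B v = cong sum (map-cong (λ j → cong (λ b → if b then 1 else 0) (A≐B v j)) (allFin _))

IsQuasicycle-resp : ∀ {n} {G : Graph n} {A B : EdgeMatrix n} →
                    (∀ i j → A i j ≡ B i j) → IsQuasicycle G A → IsQuasicycle G B
IsQuasicycle-resp A≐B qc = record
  { edgeSet = record
    { symm = λ u v → trans (sym (A≐B u v)) (trans (symm (edgeSet qc) u v) (A≐B v u))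
    ; ⊆E   = λ u v Buv → ⊆E (edgeSet qc) u v (trans (A≐B u v) Buv)
    }
  ; even = λ v → subst (2 ∣_) (deg-cong A≐B v) (even qc v)
  }

lemma2p3 : (n : ℕ) (G : Graph n) (Q : EdgeMatrix n) →
    IsQuasicycle G Q →
    IsQuasicycle G (⨁[e∈ Q ] (λ u v → s G u ∩ s G v))
lemma2p3 n G Q qc = IsQuasicycle-resp (λ i j → sym (ring-sum≡Q i j)) qc
  where
  Q⊆E : IsEdgeSet G Q
  Q⊆E = edgeSet qc
  ring-sum≡Q : ∀ i j → (⨁[e∈ Q ] (λ u v → s G u ∩ s G v)) i j ≡ Q i j
  ring-sum≡Q i j = begin
    (⨁[e∈ Q ] (λ u v → s G u ∩ s G v)) i j
      ≡⟨ ⨁-cong Q (λ u<v → s∩s≡adj∩edge G (<⇒≢ u<v)) i j ⟩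
    (⨁[e∈ Q ] (λ u v → adj G ∩ edge u v)) i j
      ≡⟨ ⨁-∩ˡ Q (adj G) edge i j ⟩
    adj G i j ∧ (⨁[e∈ Q ] edge) i j
      ≡⟨ cong (adj G i j ∧_) (⨁-edge Q (symm Q⊆E) (edgeSet-irrefl Q⊆E) i j) ⟩
    adj G i j ∧ Q i j
      ≡⟨ adj∩edgeSet Q⊆E i j ⟩
    Q i j ∎
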